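{- Let $G=K_{s,t}$ be the complete bipartite graph with partite sets $U,V$ where $s=|U|\leq |V|=t$, $s\geq 1$ and $t\geq 2$. Then $\mathrm{Z}(G)=s+t-2$ and $\mathrm{H}(G)=s+1$.
   Context: All graphs are finite, simple and undirected; $N(v)$ is the open neighborhood of $v$. Vertices are colored blue or white; starting from an initial blue set $B$, forces are applied one at a time until no further force is possible, and $B$ is a forcing set (for a given rule) if some such sequence turns every vertex blue. Standard color change rule: a blue vertex $v$ may force a white vertex $w$ if $w$ is the unique white neighbor of $v$; $\mathrm{Z}(G)$ is the minimum size of a forcing set under this rule. Hopping color change rule: a blue vertex $v$ may force any white vertex $w$ (not necessarily adjacent) if $v$ has not previously performed a force and every vertex of $N(v)$ is blue; $\mathrm{H}(G)$ is the minimum size of a forcing set under this rule. -}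

module Defs where

open import Data.Nat using (ℕ; _+_; _∸_; _≤_; _<ᵇ_)
open import Data.Bool using (Bool; true; false; _xor_; T)
open import Data.Fin using (Fin; toℕ)
open import Data.Fin.Subset using (Subset; _∈_; _∉_; ∣_∣; inside; ⊤)
open import Data.Vec using (_[_]≔_)
open import Data.Product using (Σ; ∃; ∃-syntax; _×_; _,_)
open import Relation.Binary.PropositionalEquality using (_≡_; _≢_)
open import Relation.Binary.Construct.Closure.ReflexiveTransitive using (Star)
open import Relation.Nullary using (¬_)

record Graph (n : ℕ) : Set₁ where
  field
    Adj   : Fin n → Fin n → Set
    sym   : ∀ {u v} → Adj u v → Adj v u
    irrefl : ∀ {v} → ¬ Adj v v
open Graph public

-- Complete bipartite graph K_{s,t} on Fin (s + t):
-- U = vertices with index < s (|U| = s), V = the rest (|V| = t).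
side : {n : ℕ} → ℕ → Fin n → Bool
side s i = toℕ i <ᵇ s

xor-irrefl : (b : Bool) → ¬ T (b xor b)
xor-irrefl true ()
xor-irrefl false ()

xor-sym : (a b : Bool) → T (a xor b) → T (b xor a)
xor-sym true true p = p
xor-sym true false p = p
xor-sym false true p = p
xor-sym false false p = p

K : (s t : ℕ) → Graph (s + t)
K s t = record
  { Adj = λ u v → T (side s u xor side s v)
  ; sym = λ {u} {v} → xor-sym (side s u) (side s v)
  ; irrefl = λ {v} → xor-irrefl (side s v) }

data StdStep {n : ℕ} (G : Graph n) (B : Subset n) : Subset n → Set where
  force : (v w : Fin n) → v ∈ B → w ∉ B → Adj G v w →
          (∀ u → Adj G v u → u ≢ w → u ∈ B) →
          StdStep G B (B [ w ]≔ inside)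

IsZeroForcingSet : {n : ℕ} → Graph n → Subset n → Set
IsZeroForcingSet G B = Star (StdStep G) B ⊤

-- State = (blue set, set of vertices that have already forced).
data HopStep {n : ℕ} (G : Graph n) : Subset n × Subset n → Subset n × Subset n → Set where
  force : (B D : Subset n) (v w : Fin n) → v ∈ B → v ∉ D →
          (∀ u → Adj G v u → u ∈ B) → w ∉ B →
          HopStep G (B , D) (B [ w ]≔ inside , D [ v ]≔ inside)

IsHoppingForcingSet : {n : ℕ} → Graph n → Subset n → Set
IsHoppingForcingSet {n} G B =
  ∃[ D ] Star (HopStep G) (B , Data.Fin.Subset.⊥) (⊤ , D)

IsMinSize : {n : ℕ} → (Subset n → Set) → ℕ → Set
IsMinSize {n} P k = (Σ (Subset n) λ B → P B × ∣ B ∣ ≡ k) × (∀ B → P B → k ≤ ∣ B ∣)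

ZeroForcingNumber : {n : ℕ} → Graph n → ℕ → Set
ZeroForcingNumber G k = IsMinSize (IsZeroForcingSet G) k

HoppingForcingNumber : {n : ℕ} → Graph n → ℕ → Set
HoppingForcingNumber G k = IsMinSize (IsHoppingForcingSet G) k

-- Zero forcing: if x and y are distinct white vertices with the same neighbourhood, no blue
-- vertex can have exactly one of them as its only white neighbour, so both stay white forever.
-- The vertices of one side of K_{s,t} are such twins, hence a zero forcing set misses at most
-- one vertex per side. Missing u₀ ∈ U and v₀ ∈ V suffices when t ≥ 2: another vertex of V
-- forces u₀, and then u₀ forces v₀.
-- Hopping: the first hop needs a blue vertex with blue neighbourhood, i.e. all of V plus a
-- vertex of U or all of U plus a vertex of V, at least s + 1 vertices since s ≤ t. Conversely,
-- start from U plus one vertex of V: as V is independent, the vertex of V that became blue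
-- last has a blue neighbourhood and hops to a white vertex of V, which takes over the relay.

module Submission where

open import Defs
open import Data.Nat using (ℕ; zero; suc; _+_; _∸_; _≤_; _<_; _<ᵇ_; s≤s; z≤n)
open import Data.Nat.Properties
  using (+-suc; +-comm; +-mono-≤; +-monoˡ-≤; ≤-trans; m≤n+m; m≤n+m∸n; m∸n+n≡m; module ≤-Reasoning)
open import Data.Bool using (true; false; T; _xor_)
open import Data.Fin using (Fin; zero; suc; toℕ; _↑ˡ_; _↑ʳ_; _≟_)
open import Data.Fin.Properties using (toℕ-↑ˡ; toℕ-↑ʳ; ↑ˡ-injective; ↑ʳ-injective; suc-injective)
open import Data.Fin.Subset using (Subset; _∈_; _∉_; _⊆_; ∣_∣; inside; outside; ⊤; ⊥; ⁅_⁆)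
open import Data.Fin.Subset.Properties
  using (_∈?_; ∈⊤; ∉⊥; drop-there; x∈⁅y⁆⇒x≡y; ∣p∣≤n; ∣⊤∣≡n; ∣⁅x⁆∣≡1; ∣p∣≡n⇒p≡⊤
        ; p⊆q⇒∣p∣≤∣q∣)
open import Data.Vec using (Vec; []; _∷_; _++_; _[_]=_; here; there; _[_]≔_)
import Data.Vec as Vec
open import Data.Vec.Properties
  using ( []=⇒lookup; lookup⇒[]=; lookup-++ˡ; lookup-++ʳ; lookup∘update′
        ; []≔-updates; []≔-minimal; []≔-++-↑ʳ)
open import Data.Product using (∃-syntax; _×_; _,_; proj₁; proj₂)
open import Data.Empty using (⊥-elim)
open import Function using (_∘_; case_of_)
open import Relation.Binary.Construct.Closure.ReflexiveTransitive using (Star; ε; _◅_)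
open import Relation.Binary.PropositionalEquality
  using (_≡_; _≢_; refl; trans; cong; cong₂; subst; ≢-sym; module ≡-Reasoning)
  renaming (sym to ≡-sym)
open import Relation.Nullary using (¬_; yes; no)

private
  variable
    A : Set
    m n : ℕ
    x y v w : Fin n
    B C D P : Subset n

[1+m]+[1+n]∸2≡m+n : ∀ m n → suc m + suc n ∸ 2 ≡ m + n
[1+m]+[1+n]∸2≡m+n m n = cong (_∸ 1) (+-suc m n)

[]=-++⁺ˡ : (xs : Vec A m) (ys : Vec A n) {a : A} {i : Fin m} → xs [ i ]= a → (xs ++ ys) [ i ↑ˡ n ]= a
[]=-++⁺ˡ xs ys {i = i} p = lookup⇒[]= _ _ (trans (lookup-++ˡ xs ys i) ([]=⇒lookup p))

[]=-++⁻ˡ : (xs : Vec A m) (ys : Vec A n) {a : A} {i : Fin m} → (xs ++ ys) [ i ↑ˡ n ]= a → xs [ i ]= a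
[]=-++⁻ˡ xs ys {i = i} p = lookup⇒[]= _ _ (trans (≡-sym (lookup-++ˡ xs ys i)) ([]=⇒lookup p))

[]=-++⁺ʳ : (xs : Vec A m) (ys : Vec A n) {a : A} {j : Fin n} → ys [ j ]= a → (xs ++ ys) [ m ↑ʳ j ]= a
[]=-++⁺ʳ xs ys {j = j} p = lookup⇒[]= _ _ (trans (lookup-++ʳ xs ys j) ([]=⇒lookup p))

[]=-++⁻ʳ : (xs : Vec A m) (ys : Vec A n) {a : A} {j : Fin n} → (xs ++ ys) [ m ↑ʳ j ]= a → ys [ j ]= a
[]=-++⁻ʳ xs ys {j = j} p = lookup⇒[]= _ _ (trans (≡-sym (lookup-++ʳ xs ys j)) ([]=⇒lookup p))

∣p++q∣≡∣p∣+∣q∣ : (p : Subset m) (q : Subset n) → ∣ p ++ q ∣ ≡ ∣ p ∣ + ∣ q ∣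
∣p++q∣≡∣p∣+∣q∣ []            q = refl
∣p++q∣≡∣p∣+∣q∣ (inside  ∷ p) q = cong suc (∣p++q∣≡∣p∣+∣q∣ p q)
∣p++q∣≡∣p∣+∣q∣ (outside ∷ p) q = ∣p++q∣≡∣p∣+∣q∣ p q

⊤++⊤≡⊤ : ∀ m n → ⊤ {m} ++ ⊤ {n} ≡ ⊤
⊤++⊤≡⊤ zero    n = refl
⊤++⊤≡⊤ (suc m) n = cong (inside ∷_) (⊤++⊤≡⊤ m n)

x∈p⇒0<∣p∣ : (p : Subset n) → x ∈ p → 0 < ∣ p ∣
x∈p⇒0<∣p∣ {x = x} p x∈p =
  subst (_≤ ∣ p ∣) (∣⁅x⁆∣≡1 x) (p⊆q⇒∣p∣≤∣q∣ λ y∈⁅x⁆ → subst (_∈ p) (≡-sym (x∈⁅y⁆⇒x≡y x y∈⁅x⁆)) x∈p)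

⊤⊆p⇒n≤∣p∣ : (p : Subset n) → ⊤ ⊆ p → n ≤ ∣ p ∣
⊤⊆p⇒n≤∣p∣ {n} p ⊤⊆p = subst (_≤ ∣ p ∣) (∣⊤∣≡n n) (p⊆q⇒∣p∣≤∣q∣ ⊤⊆p)

∣p∣<n⇒∃∉ : (p : Subset n) → ∣ p ∣ < n → ∃[ x ] x ∉ p
∣p∣<n⇒∃∉ (outside ∷ p) _         = zero , λ ()
∣p∣<n⇒∃∉ (inside  ∷ p) (s≤s ∣p∣<n) with x , x∉p ← ∣p∣<n⇒∃∉ p ∣p∣<n = suc x , x∉p ∘ drop-there

atMostOne∉⇒n∸1≤∣p∣ : (p : Subset n) → (∀ {x y} → x ≢ y → x ∉ p → ¬ y ∉ p) → n ∸ 1 ≤ ∣ p ∣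
atMostOne∉⇒n∸1≤∣p∣ [] _ = z≤n
atMostOne∉⇒n∸1≤∣p∣ {suc n} (inside ∷ p) unique =
  ≤-trans (m≤n+m∸n n 1)
    (s≤s (atMostOne∉⇒n∸1≤∣p∣ p λ x≢y x∉p y∉p →
      unique (x≢y ∘ suc-injective) (x∉p ∘ drop-there) (y∉p ∘ drop-there)))
atMostOne∉⇒n∸1≤∣p∣ (outside ∷ p) unique = ⊤⊆p⇒n≤∣p∣ p λ {x} _ → member x
  where
  member : ∀ x → x ∈ p
  member x with x ∈? p
  ... | yes x∈p = x∈p
  ... | no  x∉p = ⊥-elim (unique {zero} {suc x} (λ ()) (λ ()) (x∉p ∘ drop-there))

∈-≔inside⁺ : x ∈ P → x ∈ P [ w ]≔ inside
∈-≔inside⁺ {x = x} {P = P} {w = w} x∈P with w ≟ x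
... | yes refl = []≔-updates P w
... | no  w≢x  = []≔-minimal P x w (≢-sym w≢x) x∈P

∈-≔inside⁻ : w ≢ x → x ∈ P [ w ]≔ inside → x ∈ P
∈-≔inside⁻ {P = P} w≢x x∈P′ =
  lookup⇒[]= _ P (trans (≡-sym (lookup∘update′ (≢-sym w≢x) P inside)) ([]=⇒lookup x∈P′))

∣p[x]≔inside∣≡1+∣p∣ : (p : Subset n) (x : Fin n) → x ∉ p → ∣ p [ x ]≔ inside ∣ ≡ suc ∣ p ∣
∣p[x]≔inside∣≡1+∣p∣ (outside ∷ p) zero    _   = refl
∣p[x]≔inside∣≡1+∣p∣ (inside  ∷ p) zero    x∉p = ⊥-elim (x∉p here)
∣p[x]≔inside∣≡1+∣p∣ (outside ∷ p) (suc x) x∉p = ∣p[x]≔inside∣≡1+∣p∣ p x (x∉p ∘ there)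
∣p[x]≔inside∣≡1+∣p∣ (inside  ∷ p) (suc x) x∉p = cong suc (∣p[x]≔inside∣≡1+∣p∣ p x (x∉p ∘ there))

Twins : Graph n → Fin n → Fin n → Set
Twins G x y = ∀ v → (Adj G v x → Adj G v y) × (Adj G v y → Adj G v x)

ClosedBlue : Graph n → Subset n → Fin n → Set
ClosedBlue G B v = v ∈ B × (∀ u → Adj G v u → u ∈ B)

module _ {G : Graph n} where

  twins-stay-white : Twins G x y → x ≢ y → StdStep G B C → x ∉ B → y ∉ B → x ∉ C × y ∉ C
  twins-stay-white {x = x} {y = y} twins x≢y (force v w _ _ v~w unique) x∉B y∉B with w ≟ x | w ≟ y
  ... | yes refl | _        = ⊥-elim (y∉B (unique y (proj₁ (twins v) v~w) (≢-sym x≢y)))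
  ... | no  _    | yes refl = ⊥-elim (x∉B (unique x (proj₂ (twins v) v~w) x≢y))
  ... | no  w≢x  | no  w≢y  = x∉B ∘ ∈-≔inside⁻ w≢x , y∉B ∘ ∈-≔inside⁻ w≢y

  twins-stay-white⋆ : Twins G x y → x ≢ y → Star (StdStep G) B C → x ∉ B → y ∉ B → x ∉ C
  twins-stay-white⋆ _     _   ε              x∉B _   = x∉B
  twins-stay-white⋆ twins x≢y (step ◅ steps) x∉B y∉B =
    let x∉ , y∉ = twins-stay-white twins x≢y step x∉B y∉B in twins-stay-white⋆ twins x≢y steps x∉ y∉

  zeroForcingSet⇒¬whiteTwins : IsZeroForcingSet G B → Twins G x y → x ≢ y → x ∉ B → ¬ y ∉ B
  zeroForcingSet⇒¬whiteTwins forcing twins x≢y x∉B y∉B = twins-stay-white⋆ twins x≢y forcing x∉B y∉B ∈⊤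

  hoppingForcingSet⇒closedBlue : Fin n → IsHoppingForcingSet G B → ∃[ v ] ClosedBlue G B v
  hoppingForcingSet⇒closedBlue v (_ , ε) = v , ∈⊤ , λ _ _ → ∈⊤
  hoppingForcingSet⇒closedBlue _ (_ , force _ _ v _ v∈B _ N[v]⊆B _ ◅ _) = v , v∈B , N[v]⊆B

  module _ {I : Subset n} (independent : ∀ {v u} → v ∉ I → Adj G v u → u ∈ I) where

    record Relay (B D : Subset n) : Set where
      field
        I⊆B      : I ⊆ B
        D⊆B      : D ⊆ B
        runner   : Fin n
        runner∉I : runner ∉ I
        runner∈B : runner ∈ B
        runner∉D : runner ∉ D

    relay-hop : (r : Relay B D) → w ∉ B → HopStep G (B , D) (B [ w ]≔ inside , D [ Relay.runner r ]≔ inside)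
    relay-hop {B = B} {D = D} {w = w} r w∉B =
      force B D runner w runner∈B runner∉D (λ _ v~u → I⊆B (independent runner∉I v~u)) w∉B
      where open Relay r

    relay-next : (r : Relay B D) → w ∉ B → Relay (B [ w ]≔ inside) (D [ Relay.runner r ]≔ inside)
    relay-next {B = B} {D = D} {w = w} r w∉B = record
      { I⊆B      = ∈-≔inside⁺ ∘ I⊆B
      ; D⊆B      = D′⊆B′
      ; runner   = w
      ; runner∉I = w∉B ∘ I⊆B
      ; runner∈B = []≔-updates B w
      ; runner∉D = w∉B ∘ D⊆B ∘ ∈-≔inside⁻ runner≢w
      }
      where
      open Relay r
      runner≢w : runner ≢ w
      runner≢w refl = w∉B runner∈B
      D′⊆B′ : D [ runner ]≔ inside ⊆ B [ w ]≔ inside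
      D′⊆B′ {x} x∈D′ with runner ≟ x
      ... | yes refl = ∈-≔inside⁺ runner∈B
      ... | no  r≢x  = ∈-≔inside⁺ (D⊆B (∈-≔inside⁻ r≢x x∈D′))

    relay⇒⊤ : ∀ k → k + ∣ B ∣ ≡ n → Relay B D → ∃[ D′ ] Star (HopStep G) (B , D) (⊤ , D′)
    relay⇒⊤ {B = B} zero eq _ with refl ← ∣p∣≡n⇒p≡⊤ {p = B} eq = _ , ε
    relay⇒⊤ {B = B} (suc k) eq r
      with w , w∉B ← ∣p∣<n⇒∃∉ B (subst (suc ∣ B ∣ ≤_) eq (s≤s (m≤n+m ∣ B ∣ k))) =
      let D′ , hops = relay⇒⊤ k eq′ (relay-next r w∉B) in D′ , relay-hop r w∉B ◅ hops
      where
      eq′ : k + ∣ B [ w ]≔ inside ∣ ≡ n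
      eq′ = trans (cong (k +_) (∣p[x]≔inside∣≡1+∣p∣ B w w∉B)) (trans (+-suc k ∣ B ∣) eq)

    independentComplement⇒hoppingForcingSet : I ⊆ B → v ∉ I → v ∈ B → IsHoppingForcingSet G B
    independentComplement⇒hoppingForcingSet {B = B} {v = v} I⊆B v∉I v∈B =
      relay⇒⊤ (n ∸ ∣ B ∣) (m∸n+n≡m (∣p∣≤n B))
        (record { I⊆B = I⊆B ; D⊆B = ⊥-elim ∘ ∉⊥ ; runner = v
                ; runner∉I = v∉I ; runner∈B = v∈B ; runner∉D = ∉⊥ })

data Split (s t : ℕ) : Fin (s + t) → Set where
  left  : (i : Fin s) → Split s t (i ↑ˡ t)
  right : (j : Fin t) → Split s t (s ↑ʳ j)

split : ∀ s t (u : Fin (s + t)) → Split s t u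
split zero    t u       = right u
split (suc s) t zero    = left zero
split (suc s) t (suc u) with split s t u
... | left  i = left (suc i)
... | right j = right j

toℕ<ᵇn : (i : Fin n) → (toℕ i <ᵇ n) ≡ true
toℕ<ᵇn zero    = refl
toℕ<ᵇn (suc i) = toℕ<ᵇn i

m+n<ᵇm : ∀ m n → (m + n <ᵇ m) ≡ false
m+n<ᵇm zero    n = refl
m+n<ᵇm (suc m) n = m+n<ᵇm m n

side-↑ˡ : ∀ s t (i : Fin s) → side {s + t} s (i ↑ˡ t) ≡ true
side-↑ˡ s t i rewrite toℕ-↑ˡ i t = toℕ<ᵇn i

side-↑ʳ : ∀ s t (j : Fin t) → side {s + t} s (s ↑ʳ j) ≡ false
side-↑ʳ s t j rewrite toℕ-↑ʳ s j = m+n<ᵇm s (toℕ j)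

module _ {s t : ℕ} where

  K-adj-↑ˡ↑ʳ : (i : Fin s) (j : Fin t) → Adj (K s t) (i ↑ˡ t) (s ↑ʳ j)
  K-adj-↑ˡ↑ʳ i j rewrite side-↑ˡ s t i | side-↑ʳ s t j = _

  K-adj-↑ʳ↑ˡ : (j : Fin t) (i : Fin s) → Adj (K s t) (s ↑ʳ j) (i ↑ˡ t)
  K-adj-↑ʳ↑ˡ j i = Graph.sym (K s t) (K-adj-↑ˡ↑ʳ i j)

  K-¬adj-↑ˡ↑ˡ : (i i′ : Fin s) → ¬ Adj (K s t) (i ↑ˡ t) (i′ ↑ˡ t)
  K-¬adj-↑ˡ↑ˡ i i′ rewrite side-↑ˡ s t i | side-↑ˡ s t i′ = λ ()

  K-¬adj-↑ʳ↑ʳ : (j j′ : Fin t) → ¬ Adj (K s t) (s ↑ʳ j) (s ↑ʳ j′)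
  K-¬adj-↑ʳ↑ʳ j j′ rewrite side-↑ʳ s t j | side-↑ʳ s t j′ = λ ()

  sameSide⇒twins : {x y : Fin (s + t)} → side s x ≡ side s y → Twins (K s t) x y
  sameSide⇒twins x≈y v = subst (λ b → T (side s v xor b)) x≈y , subst (λ b → T (side s v xor b)) (≡-sym x≈y)

  atMostOne∉PerSide⇒[s∸1]+[t∸1]≤∣p++q∣ :
    (p : Subset s) (q : Subset t) →
    (∀ {x y} → side s x ≡ side s y → x ≢ y → x ∉ p ++ q → ¬ y ∉ p ++ q) →
    (s ∸ 1) + (t ∸ 1) ≤ ∣ p ++ q ∣
  atMostOne∉PerSide⇒[s∸1]+[t∸1]≤∣p++q∣ p q unique =
    subst ((s ∸ 1) + (t ∸ 1) ≤_) (≡-sym (∣p++q∣≡∣p∣+∣q∣ p q))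
      (+-mono-≤ (atMostOne∉⇒n∸1≤∣p∣ p uniqueˡ) (atMostOne∉⇒n∸1≤∣p∣ q uniqueʳ))
    where
    uniqueˡ : ∀ {i i′} → i ≢ i′ → i ∉ p → ¬ i′ ∉ p
    uniqueˡ {i} {i′} i≢i′ i∉p i′∉p =
      unique (trans (side-↑ˡ s t i) (≡-sym (side-↑ˡ s t i′))) (i≢i′ ∘ ↑ˡ-injective t i i′)
        (i∉p ∘ []=-++⁻ˡ p q) (i′∉p ∘ []=-++⁻ˡ p q)
    uniqueʳ : ∀ {j j′} → j ≢ j′ → j ∉ q → ¬ j′ ∉ q
    uniqueʳ {j} {j′} j≢j′ j∉q j′∉q =
      unique (trans (side-↑ʳ s t j) (≡-sym (side-↑ʳ s t j′))) (j≢j′ ∘ ↑ʳ-injective s j j′)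
        (j∉q ∘ []=-++⁻ʳ p q) (j′∉q ∘ []=-++⁻ʳ p q)

  K-zeroForcingSet⇒[s∸1]+[t∸1]≤∣B∣ : {B : Subset (s + t)} → IsZeroForcingSet (K s t) B →
                                     (s ∸ 1) + (t ∸ 1) ≤ ∣ B ∣
  K-zeroForcingSet⇒[s∸1]+[t∸1]≤∣B∣ {B} forcing with p , q , refl ← Vec.splitAt s B =
    atMostOne∉PerSide⇒[s∸1]+[t∸1]≤∣p++q∣ p q (λ x≈y → zeroForcingSet⇒¬whiteTwins forcing (sameSide⇒twins x≈y))

  K-closedBlue⇒s+1≤∣B∣ : s ≤ t → {B : Subset (s + t)} {v : Fin (s + t)} →
                         ClosedBlue (K s t) B v → s + 1 ≤ ∣ B ∣
  K-closedBlue⇒s+1≤∣B∣ s≤t {B} {v} (v∈B , N[v]⊆B) with p , q , refl ← Vec.splitAt s B | split s t v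
  ... | left i = begin
    s + 1         ≤⟨ +-monoˡ-≤ 1 s≤t ⟩
    t + 1         ≡⟨ +-comm t 1 ⟩
    1 + t         ≤⟨ +-mono-≤ (x∈p⇒0<∣p∣ p ([]=-++⁻ˡ p q v∈B))
                              (⊤⊆p⇒n≤∣p∣ q λ {j} _ → []=-++⁻ʳ p q (N[v]⊆B _ (K-adj-↑ˡ↑ʳ i j))) ⟩
    ∣ p ∣ + ∣ q ∣ ≡⟨ ≡-sym (∣p++q∣≡∣p∣+∣q∣ p q) ⟩
    ∣ p ++ q ∣    ∎
    where open ≤-Reasoning
  ... | right j = begin
    s + 1         ≤⟨ +-mono-≤ (⊤⊆p⇒n≤∣p∣ p λ {i} _ → []=-++⁻ˡ p q (N[v]⊆B _ (K-adj-↑ʳ↑ˡ j i)))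
                              (x∈p⇒0<∣p∣ q ([]=-++⁻ʳ p q v∈B)) ⟩
    ∣ p ∣ + ∣ q ∣ ≡⟨ ≡-sym (∣p++q∣≡∣p∣+∣q∣ p q) ⟩
    ∣ p ++ q ∣    ∎
    where open ≤-Reasoning

module _ (a b : ℕ) where
  private
    K′ : Graph (suc a + suc (suc b))
    K′ = K (suc a) (suc (suc b))
    u₀ v₀ v₁ : Fin (suc a + suc (suc b))
    u₀ = zero ↑ˡ suc (suc b)
    v₀ = suc a ↑ʳ zero
    v₁ = suc a ↑ʳ suc zero
    Vᵒ : Subset (suc (suc b))
    Vᵒ = outside ∷ ⊤
    allBut-v₀ : Subset (suc a + suc (suc b))
    allBut-v₀ = ⊤ {suc a} ++ Vᵒ

  K-zeroForcingSet : Subset (suc a + suc (suc b))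
  K-zeroForcingSet = (outside ∷ ⊤ {a}) ++ Vᵒ

  ∣K-zeroForcingSet∣ : ∣ K-zeroForcingSet ∣ ≡ suc a + suc (suc b) ∸ 2
  ∣K-zeroForcingSet∣ = begin
    ∣ ⊤ {a} ++ (outside ∷ ⊤ {suc b}) ∣  ≡⟨ ∣p++q∣≡∣p∣+∣q∣ (⊤ {a}) (outside ∷ ⊤ {suc b}) ⟩
    ∣ ⊤ {a} ∣ + ∣ ⊤ {suc b} ∣          ≡⟨ cong₂ _+_ (∣⊤∣≡n a) (∣⊤∣≡n (suc b)) ⟩
    a + suc b                          ≡⟨ ≡-sym ([1+m]+[1+n]∸2≡m+n a (suc b)) ⟩
    suc a + suc (suc b) ∸ 2            ∎
    where open ≡-Reasoning

  v₁-forces-u₀ : StdStep K′ K-zeroForcingSet allBut-v₀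
  v₁-forces-u₀ =
    force v₁ u₀ ([]=-++⁺ʳ (outside ∷ ⊤ {a}) Vᵒ (there ∈⊤)) (λ ()) (K-adj-↑ʳ↑ˡ {suc a} (suc zero) zero) blue
    where
    blue : ∀ u → Adj K′ v₁ u → u ≢ u₀ → u ∈ K-zeroForcingSet
    blue u v₁~u u≢u₀ with split (suc a) (suc (suc b)) u
    ... | left zero    = ⊥-elim (u≢u₀ refl)
    ... | left (suc i) = []=-++⁺ˡ (outside ∷ ⊤ {a}) Vᵒ (there ∈⊤)
    ... | right j      = ⊥-elim (K-¬adj-↑ʳ↑ʳ {suc a} (suc zero) j v₁~u)

  u₀-forces-v₀ : StdStep K′ allBut-v₀ (allBut-v₀ [ v₀ ]≔ inside)
  u₀-forces-v₀ =
    force u₀ v₀ here (λ v₀∈ → case []=-++⁻ʳ (⊤ {suc a}) Vᵒ v₀∈ of λ ())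
      (K-adj-↑ˡ↑ʳ {suc a} {suc (suc b)} zero zero) blue
    where
    blue : ∀ u → Adj K′ u₀ u → u ≢ v₀ → u ∈ allBut-v₀
    blue u u₀~u u≢v₀ with split (suc a) (suc (suc b)) u
    ... | left i        = ⊥-elim (K-¬adj-↑ˡ↑ˡ {suc a} {suc (suc b)} zero i u₀~u)
    ... | right zero    = ⊥-elim (u≢v₀ refl)
    ... | right (suc j) = []=-++⁺ʳ (⊤ {suc a}) Vᵒ (there ∈⊤)

  K-isZeroForcingSet : IsZeroForcingSet K′ K-zeroForcingSet
  K-isZeroForcingSet = subst (Star (StdStep K′) K-zeroForcingSet) all-blue (v₁-forces-u₀ ◅ u₀-forces-v₀ ◅ ε)
    where
    all-blue : allBut-v₀ [ v₀ ]≔ inside ≡ ⊤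
    all-blue = trans ([]≔-++-↑ʳ (⊤ {suc a}) Vᵒ zero) (⊤++⊤≡⊤ (suc a) (suc (suc b)))

module _ (s t : ℕ) where
  private
    noneOfV onlyV₀ : Subset (suc t)
    noneOfV = ⊥
    onlyV₀  = ⁅ zero ⁆

    U : Subset (s + suc t)
    U = ⊤ ++ noneOfV

    V-independent : ∀ {v u} → v ∉ U → Adj (K s (suc t)) v u → u ∈ U
    V-independent {v} {u} v∉U v~u with split s (suc t) v | split s (suc t) u
    ... | left i  | _        = ⊥-elim (v∉U ([]=-++⁺ˡ (⊤ {s}) noneOfV ∈⊤))
    ... | right _ | left i   = []=-++⁺ˡ (⊤ {s}) noneOfV ∈⊤
    ... | right j | right j′ = ⊥-elim (K-¬adj-↑ʳ↑ʳ {s} j j′ v~u)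

  K-hoppingForcingSet : Subset (s + suc t)
  K-hoppingForcingSet = ⊤ ++ onlyV₀

  ∣K-hoppingForcingSet∣ : ∣ K-hoppingForcingSet ∣ ≡ s + 1
  ∣K-hoppingForcingSet∣ = trans (∣p++q∣≡∣p∣+∣q∣ (⊤ {s}) onlyV₀) (cong₂ _+_ (∣⊤∣≡n s) (∣⁅x⁆∣≡1 {suc t} zero))

  K-isHoppingForcingSet : IsHoppingForcingSet (K s (suc t)) K-hoppingForcingSet
  K-isHoppingForcingSet =
    independentComplement⇒hoppingForcingSet V-independent U⊆
      (∉⊥ ∘ []=-++⁻ʳ (⊤ {s}) noneOfV) ([]=-++⁺ʳ (⊤ {s}) onlyV₀ here)
    where
    U⊆ : U ⊆ K-hoppingForcingSet
    U⊆ {x} x∈U with split s (suc t) x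
    ... | left i  = []=-++⁺ˡ (⊤ {s}) onlyV₀ ∈⊤
    ... | right j = ⊥-elim (∉⊥ ([]=-++⁻ʳ (⊤ {s}) noneOfV x∈U))

proposition2p9 : (s t : ℕ) → 1 ≤ s → s ≤ t → 2 ≤ t →
    ZeroForcingNumber (K s t) (s + t ∸ 2) × HoppingForcingNumber (K s t) (s + 1)
proposition2p9 s@(suc a) t@(suc (suc b)) (s≤s z≤n) s≤t (s≤s (s≤s z≤n)) =
  ( (K-zeroForcingSet a b , K-isZeroForcingSet a b , ∣K-zeroForcingSet∣ a b)
  , λ B forcing → subst (_≤ ∣ B ∣) (≡-sym ([1+m]+[1+n]∸2≡m+n a (suc b)))
                         (K-zeroForcingSet⇒[s∸1]+[t∸1]≤∣B∣ {s} {t} forcing) )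
  , ( (K-hoppingForcingSet s (suc b) , K-isHoppingForcingSet s (suc b) , ∣K-hoppingForcingSet∣ s (suc b))
    , λ B forcing → K-closedBlue⇒s+1≤∣B∣ s≤t (proj₂ (hoppingForcingSet⇒closedBlue zero forcing)) )
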